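{- Let $p$ be a prime, $n\ge 1$ and $\theta\subseteq[1,n]$. Then $\Omega(\theta)\wedge V$ has a resolution derivation of $\bot$ of length at most $\frac{p^{|\theta|+1}-p}{p-1}$.
   Context: Variables $\xi_{i,k}$ for $i\in[1,n]$, $k\in\mathbb{F}_p$. $V=\bigwedge_{i=1}^n\bigvee_{k\in\mathbb{F}_p}\xi_{i,k}$. For $\mathbf{x}\in\mathbb{F}_p^n$, $\mathrm{supp}(\mathbf{x})=\{i:\mathbf{x}_i\neq0\}$. $\Omega(\theta)=\{\bigvee_{i\in\theta}\overline{\xi_{i,\mathbf{x}_i}} : \mathbf{x}\in\mathbb{F}_p^n,\ \mathrm{supp}(\mathbf{x})\subseteq\theta\}$ (a set of clauses). Resolution: from $x\vee A$ and $\overline{x}\vee B$ derive $A\vee B$; the length of a derivation is the number of derived (non-original) clauses. -}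

module Defs where

open import Data.Nat using (ℕ; zero; suc; _∸_; NonZero)
open import Data.Nat.Primality using (Prime)
open import Data.Fin using (Fin; toℕ)
open import Data.Fin.Subset using (Subset; _∈_)
open import Data.List using (List; []; _∷_; _++_)
import Data.List.Membership.Propositional as LM
open import Data.Product using (Σ; ∃; _×_; _,_)
open import Data.Sum using (_⊎_)
open import Relation.Binary.PropositionalEquality using (_≡_; _≢_)
open import Function.Bundles using (_⇔_)

-- Propositional variables ξ_{i,k}, i ∈ [1,n] (as Fin n), k ∈ 𝔽_p (as Fin p,
-- with toℕ giving the residue).
Var : ℕ → ℕ → Set
Var n p = Fin n × Fin p

data Lit (n p : ℕ) : Set where
  pos : Var n p → Lit n p
  neg : Var n p → Lit n p

-- A clause is a disjunction of literals; clauses are treated as sets of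
-- literals, represented by lists compared up to having the same members.
Clause : ℕ → ℕ → Set
Clause n p = List (Lit n p)

_≈_ : ∀ {n p} → Clause n p → Clause n p → Set
C ≈ D = ∀ l → (l LM.∈ C) ⇔ (l LM.∈ D)

SuppIn : ∀ {n p} → (Fin n → Fin p) → Subset n → Set
SuppIn x θ = ∀ i → toℕ (x i) ≢ 0 → i ∈ θ

InΩ : ∀ {n p} → Subset n → Clause n p → Set
InΩ {n} {p} θ C = Σ (Fin n → Fin p) λ x → SuppIn x θ ×
  (∀ l → (l LM.∈ C) ⇔ (∃ λ i → i ∈ θ × l ≡ neg (i , x i)))

InV : ∀ {n p} → Clause n p → Set
InV {n} {p} C = Σ (Fin n) λ i →
  (∀ l → (l LM.∈ C) ⇔ (∃ λ (k : Fin p) → l ≡ pos (i , k)))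

Axiom : ∀ {n p} → Subset n → Clause n p → Set
Axiom θ C = InΩ θ C ⊎ InV C

Resolvent : ∀ {n p} → Clause n p → Clause n p → Clause n p → Set
Resolvent {n} {p} D E C = Σ (Var n p) λ x → Σ (Clause n p) λ A → Σ (Clause n p) λ B →
  (D ≈ (pos x ∷ A)) × (E ≈ (neg x ∷ B)) × (C ≈ (A ++ B))

-- Derivation from a clause set Ax: the list of derived (non-original)
-- clauses, most recent first; each is a resolvent of two clauses that are
-- original or derived earlier.
data Derivation {n p : ℕ} (Ax : Clause n p → Set) : List (Clause n p) → Set where
  []   : Derivation Ax []
  step : ∀ {Cs D E C} → Derivation Ax Cs →
         (Ax D ⊎ D LM.∈ Cs) → (Ax E ⊎ E LM.∈ Cs) → Resolvent D E C →
         Derivation Ax (C ∷ Cs)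

Derives⊥ : ∀ {n p} → (Clause n p → Set) → List (Clause n p) → Set
Derives⊥ Ax Cs = Ax [] ⊎ [] LM.∈ Cs

prime⇒nz : ∀ p → Prime p → NonZero (p ∸ 1)
prime⇒nz (suc (suc q)) _ = _

-- The refutation is tree-like.  To derive a clause R from all the clauses
-- ¬ξ_{i₁,x₁} ∨ … ∨ ¬ξ_{iₗ,xₗ} ∨ R (x ranging over assignments), derive for
-- each k ∈ 𝔽_p the clause ¬ξ_{i₁,k} ∨ R recursively from the clauses for
-- i₂,…,iₗ with side clause ¬ξ_{i₁,k} ∨ R, and resolve these p clauses one
-- after the other against the clause ξ_{i₁,0} ∨ … ∨ ξ_{i₁,p-1} of V.  This
-- costs T(l) = p (T(l-1) + 1) steps with T(0) = 0, i.e. T(l) = p + p² + … + pˡ.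
-- For i₁,…,iₗ the elements of θ and R = ⊥ the initial clauses are Ω(θ).
module Submission where

open import Defs
open import Data.Nat using (ℕ; zero; suc; _+_; _*_; _∸_; _^_; _≤_; NonZero)
open import Data.Nat.Base using (NonTrivial)
open import Data.Nat.DivMod using (_/_; m*n/n≡m)
open import Data.Nat.Primality using (Prime; prime⇒nonTrivial)
open import Data.Nat.Properties using (+-assoc; +-comm; +-identityʳ; *-identityʳ; ≤-reflexive; m+n∸n≡m)
open import Data.Nat.Tactic.RingSolver using (solve-∀)
open import Data.Fin as Fin using (Fin; zero; suc)
open import Data.Fin.Properties using (suc-injective)
open import Data.Fin.Subset using (Subset; _∈_; ∣_∣; inside; outside)
open import Data.Fin.Subset.Properties using (_∈?_)
open import Data.Vec using ([]; _∷_; here; there)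
open import Data.Vec.Functional using (updateAt)
open import Data.Vec.Functional.Properties using (updateAt-updates; updateAt-minimal)
open import Data.List using (List; []; _∷_; _++_; map; length; allFin; tabulate)
open import Data.List.Properties using (++-identityʳ; length-map; length-tabulate; map-cong-local)
open import Data.List.Membership.Propositional using () renaming (_∈_ to _∈ₗ_)
open import Data.List.Membership.Propositional.Properties using (∈-++⁻; ∈-map⁺; ∈-map⁻; ∈-allFin)
open import Data.List.Relation.Binary.Subset.Propositional using (_⊆_)
open import Data.List.Relation.Binary.Subset.Propositional.Properties using (⊆-refl; xs⊆xs++ys; xs⊆ys++xs)
open import Data.List.Relation.Binary.Permutation.Propositional using (_↭_; ↭-sym)
open import Data.List.Relation.Binary.Permutation.Propositional.Properties using (∈-resp-↭; shift)
open import Data.List.Relation.Unary.All as All using (All)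
import Data.List.Relation.Unary.All.Properties as All
open import Data.List.Relation.Unary.AllPairs using ([]; _∷_)
open import Data.List.Relation.Unary.Any using (here; there)
open import Data.List.Relation.Unary.Unique.Propositional using (Unique)
import Data.List.Relation.Unary.Unique.Propositional.Properties as Unique
open import Data.Product using (Σ; ∃; _×_; _,_)
open import Data.Sum using (_⊎_; inj₁; inj₂; [_,_]; map₂)
open import Data.Empty using (⊥-elim)
open import Function using (_∘_; const)
open import Function.Bundles using (mk⇔; Equivalence)
open import Function.Properties.Equivalence using (⇔-isEquivalence)
open import Relation.Binary.Structures using (IsEquivalence)
open import Relation.Binary.PropositionalEquality using (_≡_; _≢_; refl; sym; trans; cong; cong₂; subst; module ≡-Reasoning)
open import Relation.Nullary using (yes; no)

private
  module ⇔ {ℓ} = IsEquivalence (⇔-isEquivalence {ℓ})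

  variable
    n p : ℕ
    Ax : Clause n p → Set
    C D E R S : Clause n p
    Cs : List (Clause n p)

≈-refl : C ≈ C
≈-refl l = ⇔.refl

≈-sym : C ≈ D → D ≈ C
≈-sym C≈D l = ⇔.sym (C≈D l)

≈-trans : C ≈ D → D ≈ E → C ≈ E
≈-trans C≈D D≈E l = ⇔.trans (C≈D l) (D≈E l)

≡⇒≈ : C ≡ D → C ≈ D
≡⇒≈ refl = ≈-refl

↭⇒≈ : C ↭ D → C ≈ D
↭⇒≈ C↭D l = mk⇔ (∈-resp-↭ C↭D) (∈-resp-↭ (↭-sym C↭D))

≈[]⇒≡[] : C ≈ [] → C ≡ []
≈[]⇒≡[] {C = []}    _   = refl
≈[]⇒≡[] {C = l ∷ C} C≈[] with () ← Equivalence.to (C≈[] l) (here refl)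

++-absorbs-⊆ : (A : Clause n p) → S ⊆ R → ((A ++ S) ++ R) ≈ (A ++ R)
++-absorbs-⊆ {S = S} {R = R} A S⊆R l =
  mk⇔ (++-lub (++-lub (xs⊆xs++ys A R) (xs⊆ys++xs R A ∘ S⊆R)) (xs⊆ys++xs R A))
      (++-lub (xs⊆xs++ys (A ++ S) R ∘ xs⊆xs++ys A S) (xs⊆ys++xs R (A ++ S)))
  where
  ++-lub : ∀ {X Y Z : Clause _ _} → X ⊆ Z → Y ⊆ Z → X ++ Y ⊆ Z
  ++-lub {X} X⊆Z Y⊆Z w = [ X⊆Z , Y⊆Z ] (∈-++⁻ X w)

Resolvent-resp-≈ : {D′ E′ : Clause n p} → D′ ≈ D → E′ ≈ E → Resolvent D E C → Resolvent D′ E′ C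
Resolvent-resp-≈ D′≈D E′≈E (x , A , B , D≈ , E≈ , C≈) = x , A , B , ≈-trans D′≈D D≈ , ≈-trans E′≈E E≈ , C≈

data ResolutionTree (Ax : Clause n p → Set) : Clause n p → Set where
  axiom   : Ax D → D ≈ C → ResolutionTree Ax C
  resolve : ResolutionTree Ax D → ResolutionTree Ax E → Resolvent D E C → ResolutionTree Ax C

size : ResolutionTree Ax C → ℕ
size (axiom _ _)     = 0
size (resolve t u _) = suc (size t + size u)

Available : (Clause n p → Set) → List (Clause n p) → Clause n p → Set
Available {n} {p} Ax Cs C = Σ (Clause n p) λ D → (Ax D ⊎ D ∈ₗ Cs) × D ≈ C

linearise : (t : ResolutionTree Ax C) → Derivation Ax Cs →
  Σ (List (Clause n p)) λ Cs′ → Derivation Ax Cs′ × Available Ax Cs′ C × Cs ⊆ Cs′ ×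
    length Cs′ ≡ size t + length Cs
linearise (axiom a D≈C) d = _ , d , (_ , inj₁ a , D≈C) , ⊆-refl , refl
linearise {Cs = Cs} (resolve t u r) d
  with Cs₁ , d₁ , (D , sD , D≈) , Cs⊆Cs₁ , |Cs₁| ← linearise t d
  with Cs₂ , d₂ , (E , sE , E≈) , Cs₁⊆Cs₂ , |Cs₂| ← linearise u d₁ =
  _ ∷ Cs₂ ,
  step d₂ (map₂ Cs₁⊆Cs₂ sD) sE (Resolvent-resp-≈ D≈ E≈ r) ,
  (_ , inj₂ (here refl) , ≈-refl) ,
  (λ w → there (Cs₁⊆Cs₂ (Cs⊆Cs₁ w))) ,
  cong suc length-sum
  where
  open ≡-Reasoning
  length-sum : length Cs₂ ≡ (size t + size u) + length Cs
  length-sum = begin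
    length Cs₂                    ≡⟨ trans |Cs₂| (cong (size u +_) |Cs₁|) ⟩
    size u + (size t + length Cs) ≡⟨ sym (+-assoc (size u) (size t) (length Cs)) ⟩
    (size u + size t) + length Cs ≡⟨ cong (_+ length Cs) (+-comm (size u) (size t)) ⟩
    (size t + size u) + length Cs ∎

ResolutionTree⇒Derives⊥ : (t : ResolutionTree Ax []) →
  Σ (List (Clause n p)) λ Cs → Derivation Ax Cs × Derives⊥ Ax Cs × length Cs ≡ size t
ResolutionTree⇒Derives⊥ {Ax = Ax} t with Cs , d , (D , sD , D≈[]) , _ , |Cs| ← linearise t [] =
  Cs , d , subst (λ D → Ax D ⊎ D ∈ₗ Cs) (≈[]⇒≡[] D≈[]) sD , trans |Cs| (+-identityʳ (size t))

positives : Fin n → List (Fin p) → Clause n p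
positives i ks = map (λ k → pos (i , k)) ks

negatives : List (Fin n) → (Fin n → Fin p) → Clause n p
negatives L x = map (λ i → neg (i , x i)) L

resolve-positive : ∀ {i} (k : Fin p) (ks : List (Fin p)) →
  (t : ResolutionTree Ax (positives i (k ∷ ks) ++ S)) → (b : ResolutionTree Ax (neg (i , k) ∷ R)) → S ⊆ R →
  Σ (ResolutionTree Ax (positives i ks ++ R)) λ u → size u ≡ suc (size t + size b)
resolve-positive {i = i} k ks t b S⊆R =
  resolve t b ((i , k) , _ , _ , ≈-refl , ≈-refl , ≈-sym (++-absorbs-⊆ (positives i ks) S⊆R)) , refl

suc-+-*-suc : ∀ a s l → suc (a + s) + l * suc s ≡ a + suc l * suc s
suc-+-*-suc = solve-∀

-- S is [] while the clause of V is being resolved and R afterwards; the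
-- invariant S ⊆ R lets both share one resolution step.
resolve-positives : ∀ {i s} (k : Fin p) (ks : List (Fin p)) →
  (∀ k → Σ (ResolutionTree Ax (neg (i , k) ∷ R)) λ b → size b ≡ s) →
  (t : ResolutionTree Ax (positives i (k ∷ ks) ++ S)) → S ⊆ R →
  Σ (ResolutionTree Ax R) λ u → size u ≡ size t + length (k ∷ ks) * suc s
resolve-positives {s = s} k [] branch t S⊆R
  with b , refl ← branch k
  with u , |u| ← resolve-positive k [] t b S⊆R =
  u , trans |u| (trans (sym (+-identityʳ _)) (suc-+-*-suc (size t) s 0))
resolve-positives {s = s} k ks@(k′ ∷ ks′) branch t S⊆R
  with b , refl ← branch k
  with u , |u| ← resolve-positive k ks t b S⊆R
  with v , |v| ← resolve-positives k′ ks′ branch u ⊆-refl =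
  v , trans |v| (trans (cong (_+ length ks * suc s) |u|) (suc-+-*-suc (size t) s (length ks)))

AxiomFamily : (Clause n p → Set) → List (Fin n) → Clause n p → Set
AxiomFamily {n} {p} Ax L R = ∀ x → Σ (Clause n p) λ D → Ax D × D ≈ (negatives L x ++ R)

negatives-updateAt-∉ : ∀ {i L} (x : Fin n → Fin p) f → All (i ≢_) L → negatives L (updateAt x i f) ≡ negatives L x
negatives-updateAt-∉ {i = i} x f i∉L =
  map-cong-local (All.map (λ i≢j → cong (neg ∘ (_ ,_)) (updateAt-minimal _ i x (i≢j ∘ sym))) i∉L)

AxiomFamily-fix : ∀ {i L} → All (i ≢_) L → AxiomFamily Ax (i ∷ L) R → ∀ k → AxiomFamily Ax L (neg (i , k) ∷ R)
AxiomFamily-fix {R = R} {i = i} {L = L} i∉L family k x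
  with D , a , D≈ ← family (updateAt x i (const k)) =
  D , a , ≈-trans D≈ (≈-trans (≡⇒≈ fix-i) (↭⇒≈ (↭-sym (shift _ (negatives L x) R))))
  where
  fix-i : negatives (i ∷ L) (updateAt x i (const k)) ++ R ≡ neg (i , k) ∷ negatives L x ++ R
  fix-i = cong₂ (λ y ys → neg (i , y) ∷ ys ++ R) (updateAt-updates i x) (negatives-updateAt-∉ x (const k) i∉L)

powerSum : ℕ → ℕ → ℕ
powerSum p zero    = 0
powerSum p (suc k) = p * suc (powerSum p k)

tree-refutation : ∀ {m} {Ax : Clause n (suc m) → Set} {R} → (∀ i → Ax (positives i (allFin (suc m)))) →
  (L : List (Fin n)) → Unique L → AxiomFamily Ax L R →
  Σ (ResolutionTree Ax R) λ t → size t ≡ powerSum (suc m) (length L)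
tree-refutation V [] _ family with D , a , D≈ ← family (const zero) = axiom a D≈ , refl
tree-refutation {m = m} V (i ∷ L) (i∉L ∷ unique) family
  with t , |t| ← resolve-positives zero (tabulate suc)
                   (λ k → tree-refutation V L unique (AxiomFamily-fix i∉L family k))
                   (axiom (V i) (≡⇒≈ (sym (++-identityʳ _)))) (λ ()) =
  t , trans |t| (cong (λ l → suc l * suc (powerSum (suc m) (length L))) (length-tabulate {n = m} Fin.suc))

members : Subset n → List (Fin n)
members []             = []
members (inside  ∷ θ) = zero ∷ map suc (members θ)
members (outside ∷ θ) = map suc (members θ)

length-members : (θ : Subset n) → length (members θ) ≡ ∣ θ ∣
length-members []             = refl
length-members (inside  ∷ θ) = cong suc (trans (length-map suc (members θ)) (length-members θ))
length-members (outside ∷ θ) = trans (length-map suc (members θ)) (length-members θ)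

members-unique : (θ : Subset n) → Unique (members θ)
members-unique []             = []
members-unique (inside  ∷ θ) = All.map⁺ (All.tabulate λ _ ()) ∷ Unique.map⁺ suc-injective (members-unique θ)
members-unique (outside ∷ θ) = Unique.map⁺ suc-injective (members-unique θ)

∈-members⁺ : ∀ {i} (θ : Subset n) → i ∈ θ → i ∈ₗ members θ
∈-members⁺ (inside  ∷ θ) here      = here refl
∈-members⁺ (inside  ∷ θ) (there w) = there (∈-map⁺ suc (∈-members⁺ θ w))
∈-members⁺ (outside ∷ θ) (there w) = ∈-map⁺ suc (∈-members⁺ θ w)

∈-members⁻ : ∀ {i} (θ : Subset n) → i ∈ₗ members θ → i ∈ θ
∈-members⁻ (inside  ∷ θ) (here refl) = here
∈-members⁻ (inside  ∷ θ) (there w) with _ , w′ , refl ← ∈-map⁻ suc w = there (∈-members⁻ θ w′)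
∈-members⁻ (outside ∷ θ) w         with _ , w′ , refl ← ∈-map⁻ suc w = there (∈-members⁻ θ w′)

restrict : ∀ {m} → Subset n → (Fin n → Fin (suc m)) → Fin n → Fin (suc m)
restrict θ x i with i ∈? θ
... | yes _ = x i
... | no  _ = zero

restrict-∈ : ∀ {m i} (θ : Subset n) (x : Fin n → Fin (suc m)) → i ∈ θ → restrict θ x i ≡ x i
restrict-∈ {i = i} θ x i∈θ with i ∈? θ
... | yes _   = refl
... | no  i∉θ = ⊥-elim (i∉θ i∈θ)

SuppIn-restrict : ∀ {m} (θ : Subset n) (x : Fin n → Fin (suc m)) → SuppIn (restrict θ x) θ
SuppIn-restrict θ x i x≢0 with i ∈? θ
... | yes i∈θ = i∈θ
... | no  _   = ⊥-elim (x≢0 refl)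

V-axiom : (θ : Subset n) (i : Fin n) → Axiom {p = p} θ (positives i (allFin p))
V-axiom θ i = inj₂ (i , λ l → mk⇔ (λ w → let k , _ , l≡ = ∈-map⁻ _ w in k , l≡)
                                  (λ { (k , refl) → ∈-map⁺ _ (∈-allFin k) }))

-- The clause of x only reads x on θ, so x restricted to θ is a witness for Ω(θ).
Ω-family : ∀ {m} (θ : Subset n) → AxiomFamily {p = suc m} (Axiom θ) (members θ) []
Ω-family θ x = negatives (members θ) y , inj₁ (y , SuppIn-restrict θ x , λ l → mk⇔ to from) , ≡⇒≈ agrees
  where
  y : Fin _ → Fin _
  y = restrict θ x
  to : ∀ {l} → l ∈ₗ negatives (members θ) y → ∃ λ i → i ∈ θ × l ≡ neg (i , y i)
  to w = let i , i∈ , l≡ = ∈-map⁻ _ w in i , ∈-members⁻ θ i∈ , l≡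
  from : ∀ {l} → (∃ λ i → i ∈ θ × l ≡ neg (i , y i)) → l ∈ₗ negatives (members θ) y
  from (i , i∈θ , refl) = ∈-map⁺ _ (∈-members⁺ θ i∈θ)
  agrees : negatives (members θ) y ≡ negatives (members θ) x ++ []
  agrees = trans (map-cong-local (All.tabulate λ i∈ → cong (neg ∘ (_ ,_)) (restrict-∈ θ x (∈-members⁻ θ i∈))))
                 (sym (++-identityʳ _))

Ω∧V-refutation : ∀ {m} (θ : Subset n) →
  Σ (List (Clause n (suc m))) λ Cs →
    Derivation (Axiom θ) Cs × Derives⊥ (Axiom θ) Cs × length Cs ≡ powerSum (suc m) ∣ θ ∣
Ω∧V-refutation θ
  with t , |t| ← tree-refutation (V-axiom θ) (members θ) (members-unique θ) (Ω-family θ)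
  with Cs , d , ⊥∈Cs , |Cs| ← ResolutionTree⇒Derives⊥ t =
  Cs , d , ⊥∈Cs , trans |Cs| (trans |t| (cong (powerSum _) (length-members θ)))

powerSum-geometric : ∀ q k → powerSum (suc q) k * q + suc q ≡ suc q ^ (k + 1)
powerSum-geometric q zero    = sym (*-identityʳ (suc q))
powerSum-geometric q (suc k) = trans (factor q (powerSum (suc q) k)) (cong (suc q *_) (powerSum-geometric q k))
  where
  factor : ∀ q s → suc q * suc s * q + suc q ≡ suc q * (s * q + suc q)
  factor = solve-∀

powerSum-quotient : ∀ q k .{{_ : NonZero q}} → (suc q ^ (k + 1) ∸ suc q) / q ≡ powerSum (suc q) k
powerSum-quotient q k = begin
  (suc q ^ (k + 1) ∸ suc q) / q  ≡⟨ cong (λ z → (z ∸ suc q) / q) (sym (powerSum-geometric q k)) ⟩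
  (Σp * q + suc q ∸ suc q) / q   ≡⟨ cong (_/ q) (m+n∸n≡m (Σp * q) (suc q)) ⟩
  (Σp * q) / q                   ≡⟨ m*n/n≡m Σp q ⟩
  Σp                             ∎
  where
  open ≡-Reasoning
  Σp : ℕ
  Σp = powerSum (suc q) k

lemma4p1 : (p : ℕ) (pr : Prime p) (n : ℕ) → 1 ≤ n → (θ : Subset n) →
    Σ (List (Clause n p)) λ Cs →
      Derivation (Axiom θ) Cs × Derives⊥ (Axiom θ) Cs ×
      length Cs ≤ _/_ (p ^ (∣ θ ∣ + 1) ∸ p) (p ∸ 1) {{prime⇒nz p pr}}
lemma4p1 0 pr n _ θ = ⊥-elim (NonTrivial.nonTrivial (prime⇒nonTrivial pr))
lemma4p1 1 pr n _ θ = ⊥-elim (NonTrivial.nonTrivial (prime⇒nonTrivial pr))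
lemma4p1 (suc (suc q)) pr n _ θ with Cs , d , ⊥∈Cs , |Cs| ← Ω∧V-refutation θ =
  Cs , d , ⊥∈Cs , ≤-reflexive (trans |Cs| (sym (powerSum-quotient (suc q) ∣ θ ∣)))
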